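{- Let $N\ge 2$. Starting from the state $0^{N-1}=(0,\dots,0)\in\mathbb{N}^{N-1}$, any final state reached by a sequence of moves is of the form $1^k\,2\,1^{N-2-k}$ (i.e. $k$ ones, then a single $2$, then $N-2-k$ ones) for some $k\in\{0,\dots,N-2\}$.
   Context: A state is a tuple $a=(a_1,\dots,a_m)$ of nonnegative integers; powers denote repetition of an entry, e.g. $1^k$ is $k$ consecutive ones. A move from a state $a$ to a state $a'$ is performed as follows: choose a triggering position $T$ with $a_T=0$; set $a'_T=2$; if there exists $j<T$ with $a_j>0$, take the largest such $j$ and set $a'_j=a_j-1$; if there exists $j>T$ with $a_j>0$, take the smallest such $j$ and set $a'_j=a_j-1$; all other entries are unchanged. A state is final if it contains no entry equal to $0$ (so no move is possible). -}

module Defs where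

open import Data.Nat using (ℕ; zero; suc; _∸_; _+_; _>_)
open import Data.Vec using (Vec; lookup; replicate; _++_; _∷_)
open import Data.Fin using (Fin) renaming (_<_ to _<ᶠ_)
open import Data.Product using (Σ; ∃; _×_; _,_)
open import Data.Sum using (_⊎_)
open import Data.Empty using (⊥)
open import Relation.Binary.PropositionalEquality using (_≡_; _≢_)
open import Relation.Binary.Construct.Closure.ReflexiveTransitive using (Star)
open import Relation.Nullary using (¬_)

State : ℕ → Set
State m = Vec ℕ m

NearestLeft : ∀ {m} → State m → (T j : Fin m) → Set
NearestLeft a T j =
  j <ᶠ T × lookup a j > 0 × (∀ i → j <ᶠ i → i <ᶠ T → lookup a i ≡ 0)

NearestRight : ∀ {m} → State m → (T j : Fin m) → Set
NearestRight a T j =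
  T <ᶠ j × lookup a j > 0 × (∀ i → T <ᶠ i → i <ᶠ j → lookup a i ≡ 0)

MoveAt : ∀ {m} → State m → Fin m → State m → Set
MoveAt a T a' =
  lookup a T ≡ 0 ×
  lookup a' T ≡ 2 ×
  (∀ j → j ≢ T →
     ((NearestLeft a T j ⊎ NearestRight a T j) → lookup a' j ≡ lookup a j ∸ 1) ×
     (¬ NearestLeft a T j → ¬ NearestRight a T j → lookup a' j ≡ lookup a j))

Move : ∀ {m} → State m → State m → Set
Move a a' = ∃ λ T → MoveAt a T a'

Reachable : ∀ {m} → State m → State m → Set
Reachable = Star Move

Final : ∀ {m} → State m → Set
Final a = ∀ j → lookup a j ≢ 0

{-# OPTIONS --safe #-}
module Submission where

-- Every state reachable from 0^(N-1) has all entries at most 2, and any two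
-- entries equal to 2 have a 0 strictly between them.  A move creates its 2 at
-- a former 0; the entries it decrements, being nearest positive neighbours of
-- the trigger, either drop to 0 or were 2s that leave a 0 behind them, so the
-- invariant survives.  In a final state there is no 0, hence at most one 2, and
-- after at least one move there is exactly one, all other entries being 1.

open import Defs
open import Data.Nat using (ℕ; zero; suc; _+_; _∸_; _≤_; _≥_; _>_; s≤s; z≤n; _≤?_; _<?_)
import Data.Nat.Properties as ℕ
open import Data.Vec using (Vec; []; _∷_; replicate; _++_; cast; lookup)
open import Data.Vec.Properties using (lookup-replicate; cast-is-id)
open import Data.Fin as Fin using (Fin; toℕ) renaming (_<_ to _<ᶠ_; _>_ to _>ᶠ_; _≤_ to _≤ᶠ_)
import Data.Fin.Properties as Fin
open import Data.Fin.Induction using (<-wellFounded; >-wellFounded)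
open import Induction.WellFounded using (Acc; acc)
open import Data.Product using (Σ; ∃; _×_; _,_; proj₁; proj₂)
open import Data.Sum using (_⊎_; inj₁; inj₂)
open import Data.Empty using (⊥-elim)
open import Function using (_∘_; id)
open import Relation.Nullary using (¬_; yes; no)
open import Relation.Nullary.Decidable using (_×-dec_; decidable-stable)
open import Relation.Binary using (tri<; tri≈; tri>)
open import Relation.Binary.PropositionalEquality using (_≡_; _≢_; refl; sym; trans; cong; cong₂; subst)
open import Relation.Binary.Construct.Closure.ReflexiveTransitive using (ε; _◅_)

positive-≤2 : ∀ {n} → n > 0 → n ≤ 2 → n ≡ 1 ⊎ n ≡ 2
positive-≤2 {1} _ _ = inj₁ refl
positive-≤2 {2} _ _ = inj₂ refl
positive-≤2 {suc (suc (suc _))} _ (s≤s (s≤s ()))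

≯0⇒≡0 : ∀ {n} → ¬ n > 0 → n ≡ 0
≯0⇒≡0 = ℕ.n≤0⇒n≡0 ∘ ℕ.≮⇒≥

ZeroBetween : ∀ {m} → State m → Fin m → Fin m → Set
ZeroBetween a i j = ∃ λ k → i <ᶠ k × k <ᶠ j × lookup a k ≡ 0

Nearest : ∀ {m} → State m → (T j : Fin m) → Set
Nearest a T j = NearestLeft a T j ⊎ NearestRight a T j

module _ {m} (a : State m) where

  nearestLeft-acc : ∀ {T i} → Acc _>ᶠ_ i → i <ᶠ T → lookup a i > 0 →
                    ∃ λ L → i ≤ᶠ L × NearestLeft a T L
  nearestLeft-acc {T} {i} (acc rec) i<T ai>0
    with Fin.any? (λ k → Fin._<?_ i k ×-dec Fin._<?_ k T ×-dec (0 <? lookup a k))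
  ... | yes (k , i<k , k<T , ak>0) =
    let L , k≤L , nearest = nearestLeft-acc (rec i<k) k<T ak>0
    in L , ℕ.≤-trans (ℕ.<⇒≤ i<k) k≤L , nearest
  ... | no none =
    i , ℕ.≤-refl , i<T , ai>0 , λ k i<k k<T → ≯0⇒≡0 (λ ak>0 → none (k , i<k , k<T , ak>0))

  nearestLeft : ∀ {T i} → i <ᶠ T → lookup a i > 0 → ∃ λ L → i ≤ᶠ L × NearestLeft a T L
  nearestLeft {i = i} = nearestLeft-acc (>-wellFounded i)

  nearestRight-acc : ∀ {T j} → Acc _<ᶠ_ j → T <ᶠ j → lookup a j > 0 →
                     ∃ λ R → R ≤ᶠ j × NearestRight a T R
  nearestRight-acc {T} {j} (acc rec) T<j aj>0
    with Fin.any? (λ k → Fin._<?_ T k ×-dec Fin._<?_ k j ×-dec (0 <? lookup a k))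
  ... | yes (k , T<k , k<j , ak>0) =
    let R , R≤k , nearest = nearestRight-acc (rec k<j) T<k ak>0
    in R , ℕ.≤-trans R≤k (ℕ.<⇒≤ k<j) , nearest
  ... | no none =
    j , ℕ.≤-refl , T<j , aj>0 , λ k T<k k<j → ≯0⇒≡0 (λ ak>0 → none (k , T<k , k<j , ak>0))

  nearestRight : ∀ {T j} → T <ᶠ j → lookup a j > 0 → ∃ λ R → R ≤ᶠ j × NearestRight a T R
  nearestRight {j = j} = nearestRight-acc (<-wellFounded j)

module MoveAt-properties {m} {a a' : State m} {T : Fin m} (move : MoveAt a T a') where

  trigger-becomes-2 : lookup a' T ≡ 2
  trigger-becomes-2 = proj₁ (proj₂ move)

  nearest-decremented : ∀ {j} → j ≢ T → Nearest a T j → lookup a' j ≡ lookup a j ∸ 1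
  nearest-decremented j≢T = proj₁ (proj₂ (proj₂ move) _ j≢T)

  -- Being a nearest positive entry is not known to be decidable, but the goal is.
  nonincreasing : ∀ {j} → j ≢ T → lookup a' j ≤ lookup a j
  nonincreasing {j} j≢T = decidable-stable (_ ≤? _) λ ≰ →
    ≰ (ℕ.≤-reflexive (proj₂ (proj₂ (proj₂ move) j j≢T) (≰ ∘ decremented-≤ ∘ inj₁) (≰ ∘ decremented-≤ ∘ inj₂)))
    where
    decremented-≤ : Nearest a T j → lookup a' j ≤ lookup a j
    decremented-≤ n = subst (_≤ lookup a j) (sym (nearest-decremented j≢T n)) (ℕ.m∸n≤m _ 1)

  keeps-0 : ∀ {j} → j ≢ T → lookup a j ≡ 0 → lookup a' j ≡ 0
  keeps-0 j≢T aj≡0 = ℕ.n≤0⇒n≡0 (subst (_ ≤_) aj≡0 (nonincreasing j≢T))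

  nearest-2-not-kept : ∀ {j} → j ≢ T → Nearest a T j → lookup a j ≡ 2 → lookup a' j ≢ 2
  nearest-2-not-kept j≢T n aj≡2 a'j≡2
    with trans (sym a'j≡2) (trans (nearest-decremented j≢T n) (cong (_∸ 1) aj≡2))
  ... | ()

record Invariant {m} (a : State m) : Set where
  field
    entries≤2 : ∀ j → lookup a j ≤ 2
    twos-separated : ∀ {i j} → i <ᶠ j → lookup a i ≡ 2 → lookup a j ≡ 2 → ZeroBetween a i j

open Invariant

invariant-initial : ∀ m → Invariant (replicate m 0)
invariant-initial m .entries≤2 j = subst (_≤ 2) (sym (lookup-replicate j 0)) z≤n
invariant-initial m .twos-separated {i} _ ai≡2 _ with trans (sym (lookup-replicate i 0)) ai≡2
... | ()

module Invariant-preservation {m} {a a' : State m} {T : Fin m} (move : MoveAt a T a') (inv : Invariant a) where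
  open MoveAt-properties {a = a} {a'} move

  ≢T : ∀ {j} → T <ᶠ j → j ≢ T
  ≢T T<j = Fin.<⇒≢ T<j ∘ sym

  two-after⇒two-before : ∀ {j} → j ≢ T → lookup a' j ≡ 2 → lookup a j ≡ 2
  two-after⇒two-before j≢T a'j≡2 =
    ℕ.≤-antisym (inv .entries≤2 _) (subst (_≤ _) a'j≡2 (nonincreasing j≢T))

  zero-before-trigger : ∀ {i} → i <ᶠ T → lookup a i ≡ 2 → lookup a' i ≡ 2 → ZeroBetween a' i T
  zero-before-trigger {i} i<T ai≡2 a'i≡2
    with nearestLeft a i<T (subst (_> 0) (sym ai≡2) (s≤s z≤n))
  ... | L , i≤L , nl@(L<T , aL>0 , _) with i Fin.≟ L
  ...   | yes refl = ⊥-elim (nearest-2-not-kept (Fin.<⇒≢ i<T) (inj₁ nl) ai≡2 a'i≡2)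
  ...   | no i≢L with Fin.≤∧≢⇒< i≤L i≢L | positive-≤2 aL>0 (inv .entries≤2 L)
  ...     | i<L | inj₁ aL≡1 =
    L , i<L , L<T , trans (nearest-decremented (Fin.<⇒≢ L<T) (inj₁ nl)) (cong (_∸ 1) aL≡1)
  ...     | i<L | inj₂ aL≡2 =
    let k , i<k , k<L , ak≡0 = inv .twos-separated i<L ai≡2 aL≡2
        k<T = ℕ.<-trans k<L L<T
    in k , i<k , k<T , keeps-0 (Fin.<⇒≢ k<T) ak≡0

  zero-after-trigger : ∀ {j} → T <ᶠ j → lookup a j ≡ 2 → lookup a' j ≡ 2 → ZeroBetween a' T j
  zero-after-trigger {j} T<j aj≡2 a'j≡2
    with nearestRight a T<j (subst (_> 0) (sym aj≡2) (s≤s z≤n))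
  ... | R , R≤j , nr@(T<R , aR>0 , _) with R Fin.≟ j
  ...   | yes refl = ⊥-elim (nearest-2-not-kept (≢T T<j) (inj₂ nr) aj≡2 a'j≡2)
  ...   | no R≢j with Fin.≤∧≢⇒< R≤j R≢j | positive-≤2 aR>0 (inv .entries≤2 R)
  ...     | R<j | inj₁ aR≡1 =
    R , T<R , R<j , trans (nearest-decremented (≢T T<R) (inj₂ nr)) (cong (_∸ 1) aR≡1)
  ...     | R<j | inj₂ aR≡2 =
    let k , R<k , k<j , ak≡0 = inv .twos-separated R<j aR≡2 aj≡2
        T<k = ℕ.<-trans T<R R<k
    in k , T<k , k<j , keeps-0 (≢T T<k) ak≡0

  invariant-after : Invariant a'
  invariant-after .entries≤2 j with j Fin.≟ T
  ... | yes refl = ℕ.≤-reflexive trigger-becomes-2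
  ... | no j≢T = ℕ.≤-trans (nonincreasing j≢T) (inv .entries≤2 j)
  invariant-after .twos-separated {i} {j} i<j a'i≡2 a'j≡2 with i Fin.≟ T | j Fin.≟ T
  ... | yes refl | _ = zero-after-trigger i<j (two-after⇒two-before (≢T i<j) a'j≡2) a'j≡2
  ... | no i≢T | yes refl = zero-before-trigger i<j (two-after⇒two-before i≢T a'i≡2) a'i≡2
  ... | no i≢T | no j≢T
    with inv .twos-separated i<j (two-after⇒two-before i≢T a'i≡2) (two-after⇒two-before j≢T a'j≡2)
  ...   | k , i<k , k<j , ak≡0 with k Fin.≟ T
  ...     | no k≢T = k , i<k , k<j , keeps-0 k≢T ak≡0
  ...     | yes refl =
    let k' , i<k' , k'<T , a'k'≡0 = zero-before-trigger i<k (two-after⇒two-before i≢T a'i≡2) a'i≡2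
    in k' , i<k' , ℕ.<-trans k'<T k<j , a'k'≡0

invariant-reachable : ∀ {m} {a b : State m} → Reachable a b → Invariant a → Invariant b
invariant-reachable ε = id
invariant-reachable ((_ , move) ◅ path) = invariant-reachable path ∘ Invariant-preservation.invariant-after move

reachable⇒≡⊎has-2 : ∀ {m} {a b : State m} → Reachable a b → a ≡ b ⊎ ∃ λ j → lookup b j ≡ 2
reachable⇒≡⊎has-2 ε = inj₁ refl
reachable⇒≡⊎has-2 {a = a} (_◅_ {j = a'} (T , move) path) with reachable⇒≡⊎has-2 path
... | inj₁ refl = inj₂ (T , MoveAt-properties.trigger-becomes-2 {a = a} {a'} move)
... | inj₂ two = inj₂ two

final⇒no-ZeroBetween : ∀ {m} {a : State m} {i j} → Final a → ¬ ZeroBetween a i j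
final⇒no-ZeroBetween final (k , _ , _ , ak≡0) = final k ak≡0

final⇒others≡1 : ∀ {m} {a : State m} → Invariant a → Final a →
                 ∀ {p} → lookup a p ≡ 2 → ∀ q → q ≢ p → lookup a q ≡ 1
final⇒others≡1 {a = a} inv final {p} ap≡2 q q≢p
  with positive-≤2 (ℕ.n≢0⇒n>0 (final q)) (inv .entries≤2 q)
... | inj₁ aq≡1 = aq≡1
... | inj₂ aq≡2 with Fin.<-cmp q p
...   | tri< q<p _ _ = ⊥-elim (final⇒no-ZeroBetween {a = a} final (inv .twos-separated q<p aq≡2 ap≡2))
...   | tri≈ _ q≡p _ = ⊥-elim (q≢p q≡p)
...   | tri> _ _ p<q = ⊥-elim (final⇒no-ZeroBetween {a = a} final (inv .twos-separated p<q ap≡2 aq≡2))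

replicate-unique : ∀ {A : Set} {n x} (v : Vec A n) → (∀ q → lookup v q ≡ x) → replicate n x ≡ v
replicate-unique [] _ = refl
replicate-unique (y ∷ v) h = cong₂ _∷_ (sym (h Fin.zero)) (replicate-unique v (h ∘ Fin.suc))

replicate-++-∷-replicate : ∀ {A : Set} {n x y} (v : Vec A (suc n)) (p : Fin (suc n)) →
  lookup v p ≡ y → (∀ q → q ≢ p → lookup v q ≡ x) →
  .(eq : toℕ p + suc (n ∸ toℕ p) ≡ suc n) →
  cast eq (replicate (toℕ p) x ++ y ∷ replicate (n ∸ toℕ p) x) ≡ v
replicate-++-∷-replicate (z ∷ v) Fin.zero vp≡y others eq =
  cong₂ _∷_ (sym vp≡y) (trans (cast-is-id _ _) (replicate-unique v (λ q → others (Fin.suc q) λ ())))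
replicate-++-∷-replicate {n = suc n} (z ∷ v) (Fin.suc p) vp≡y others eq =
  cong₂ _∷_ (sym (others Fin.zero λ ()))
            (replicate-++-∷-replicate v p vp≡y (λ q q≢p → others (Fin.suc q) (q≢p ∘ Fin.suc-injective))
                                      (ℕ.suc-injective eq))

mainTheorem3 : (N : ℕ) → N ≥ 2 → (a : State (N ∸ 1)) →
    Reachable (replicate (N ∸ 1) 0) a → Final a →
    Σ ℕ λ k → Σ (k ≤ N ∸ 2) λ _ →
      Σ (k + (1 + (N ∸ 2 ∸ k)) ≡ N ∸ 1) λ eq →
        cast eq (replicate k 1 ++ (2 ∷ replicate (N ∸ 2 ∸ k) 1)) ≡ a
mainTheorem3 (suc zero) (s≤s ())
mainTheorem3 (suc (suc n)) _ a reach final with reachable⇒≡⊎has-2 reach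
... | inj₁ refl = ⊥-elim (final Fin.zero refl)
... | inj₂ (p , ap≡2) =
  toℕ p , p≤n , lengths ,
  replicate-++-∷-replicate a p ap≡2 (final⇒others≡1 inv final ap≡2) lengths
  where
  inv : Invariant a
  inv = invariant-reachable reach (invariant-initial (suc n))
  p≤n : toℕ p ≤ n
  p≤n = ℕ.≤-pred (Fin.toℕ<n p)
  lengths : toℕ p + suc (n ∸ toℕ p) ≡ suc n
  lengths = trans (ℕ.+-suc (toℕ p) (n ∸ toℕ p)) (cong suc (ℕ.m+[n∸m]≡n p≤n))
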